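{- Let $G=(V,E)$ be an oriented circular-arc catch digraph which is unilateral. Then $G$ has a (directed) Hamiltonian path.
   Context: A simple digraph $G=(V,E)$ is a circular-arc catch digraph if to each $v\in V$ one can associate a circular arc $I_v$ on a circle and a point $p_v\in I_v$ such that for distinct $u,v\in V$, $uv\in E$ if and only if $p_v\in I_u$. It is oriented if there are no distinct $u,v$ with both $uv\in E$ and $vu\in E$. A digraph is unilateral (unilaterally connected) if for every pair of distinct vertices $u,v$ there is a directed path from $u$ to $v$ or from $v$ to $u$. -}

module Defs where

open import Data.Nat using (ℕ; suc; _+_; _≤_; _<_; _%_)
open import Data.Fin using (Fin; toℕ; fromℕ<)
open import Data.Product using (Σ; _×_; ∃; ∃-syntax)
open import Data.Sum using (_⊎_)
open import Data.Empty using (⊥)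
open import Relation.Binary.PropositionalEquality using (_≡_; _≢_)
open import Relation.Nullary using (¬_)
open import Relation.Binary.Construct.Closure.ReflexiveTransitive using (Star)
open import Function.Definitions using (Injective)

Digraph : ℕ → Set₁
Digraph n = Fin n → Fin n → Set

-- Simple: no loops (parallel edges are impossible for a relation).
Loopless : ∀ {n} → Digraph n → Set
Loopless {n} E = (v : Fin n) → ¬ E v v

-- The circle: a cyclically ordered finite set of c = suc k positions.
-- A (closed) circular arc: a start position and a length ℓ < c; it covers
-- the positions s, s+1, ..., s+ℓ (mod c).
record Arc (c : ℕ) : Set where
  constructor arc
  field
    start  : Fin c
    len    : ℕ
    len<c  : len < c

_∈Arc_ : ∀ {k} → Fin (suc k) → Arc (suc k) → Set
_∈Arc_ {k} x (arc s ℓ _) = ∃[ j ] (j ≤ ℓ × (toℕ s + j) % suc k ≡ toℕ x)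

IsCircularArcCatchDigraph : ∀ {n} → Digraph n → Set
IsCircularArcCatchDigraph {n} E =
  ∃[ k ] Σ (Fin n → Arc (suc k)) λ I → Σ (Fin n → Fin (suc k)) λ p →
    ((v : Fin n) → p v ∈Arc I v) ×
    ((u v : Fin n) → u ≢ v →
       (E u v → p v ∈Arc I u) × (p v ∈Arc I u → E u v))

Oriented : ∀ {n} → Digraph n → Set
Oriented {n} E = (u v : Fin n) → u ≢ v → E u v → E v u → ⊥

Unilateral : ∀ {n} → Digraph n → Set
Unilateral {n} E = (u v : Fin n) → u ≢ v → Star E u v ⊎ Star E v u

-- Hamiltonian path: an ordering σ(0), ..., σ(n-1) of all vertices
-- (σ injective, hence bijective on Fin n) with each σ(i) σ(i+1) an edge.
HasHamiltonianPath : ∀ {n} → Digraph n → Set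
HasHamiltonianPath {n} E =
  Σ (Fin n → Fin n) λ σ → Injective _≡_ _≡_ σ ×
    ((i : ℕ) (i+1<n : suc i < n) →
       E (σ (fromℕ< (Data.Nat.Properties.<-trans (Data.Nat.Properties.n<1+n i) i+1<n)))
         (σ (fromℕ< i+1<n)))
  where import Data.Nat.Properties

-- Let y be the sink of G if G has one (it is unique, G being unilateral) and any vertex otherwise;
-- a Hamiltonian path ending at y is built backwards. Deleting y leaves a catch digraph, which is
-- still unilateral and has a vertex q with an edge to y. If y is a sink, this holds because no path
-- between other vertices passes through y. If G has no sink, every arc I_u reaches past p_u, so it
-- contains the point next to p_u clockwise or the one next to it counter-clockwise; orientedness
-- forces all vertices to make the same choice, say clockwise. Then following clockwise neighbours
-- leads from any vertex to any later one before y, and the clockwise predecessor of y points to y.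
-- The path of G - y is made to end at its sink if it has one (that sink must point to y), at q otherwise.
module Submission where

open import Data.Nat using (ℕ)
open import Defs

open import Data.Nat using (zero; suc; _+_; _∸_; _≤_; _<_; _%_; _≤?_; _<?_; z≤n; s≤s; z<s; NonZero)
open import Data.Nat.Properties hiding (_≟_)
open import Data.Nat.DivMod using (m%n<n; m<n⇒m%n≡m; [m+n]%n≡m%n; %-distribˡ-+; m%n%n≡m%n)
open import Data.Nat.Induction using (<-wellFounded)
open import Data.Fin using (Fin; toℕ; fromℕ<; punchIn; punchOut) renaming (zero to fzero)
open import Data.Fin.Properties
  using (_≟_; toℕ<n; toℕ-injective; toℕ-fromℕ<; any?; all?; ¬∀⟶∃¬;
         punchIn-injective; punchInᵢ≢i; punchIn-punchOut)
open import Data.List using (List; filter; allFin)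
open import Data.List.Extrema.Nat using (argmin; argmin-sel; f[argmin]≤f[xs])
open import Data.List.Membership.Propositional.Properties using (∈-filter⁺; ∈-filter⁻; ∈-allFin)
import Data.List.Relation.Unary.All as All
open import Data.Product using (_×_; _,_; ∃; proj₁; proj₂)
open import Data.Sum as Sum using (_⊎_; inj₁; inj₂; swap)
open import Data.Empty using (⊥; ⊥-elim)
open import Function using (flip; _on_; _∘_)
open import Function.Definitions using (Injective)
open import Induction.WellFounded using (Acc; acc)
open import Relation.Nullary using (¬_; Dec; yes; no; ¬?)
open import Relation.Nullary.Decidable using (map′; decidable-stable)
open import Relation.Binary.Definitions using (Decidable; tri<; tri≈; tri>)
open import Relation.Binary.Construct.Closure.ReflexiveTransitive using (Star; ε; _◅_)
open import Relation.Binary.PropositionalEquality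

-- Clockwise distances of points placed on a circle of circumference c: walking clockwise from x
-- through y to z either stops at z or passes it once more after a full turn.
record IsCyclicDistance {A : Set} (c : ℕ) (d : A → A → ℕ) : Set where
  field
    d<c      : ∀ x y → d x y < c
    d≡0⇒≡    : ∀ {x y} → d x y ≡ 0 → x ≡ y
    triangle : ∀ x y z → d x y + d y z ≡ d x z ⊎ d x y + d y z ≡ d x z + c

Nearest : ∀ {A : Set} → (A → A → ℕ) → A → A → Set
Nearest d u v = v ≢ u × (∀ w → w ≢ u → d u v ≤ d u w)

module CyclicDistance {A : Set} {c : ℕ} {d : A → A → ℕ} (cyc : IsCyclicDistance c d) where
  open IsCyclicDistance cyc public

  d-refl : ∀ x → d x x ≡ 0
  d-refl x with triangle x x x
  ... | inj₁ p = +-cancelˡ-≡ (d x x) _ _ (trans p (sym (+-identityʳ (d x x))))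
  ... | inj₂ p = ⊥-elim (<⇒≢ (d<c x x) (+-cancelˡ-≡ (d x x) _ _ p))

  d-pos : ∀ {x y} → x ≢ y → 0 < d x y
  d-pos x≢y = n≢0⇒n>0 (x≢y ∘ d≡0⇒≡)

  d-injʳ : ∀ {x y z} → d x y ≡ d x z → y ≡ z
  d-injʳ {x} {y} {z} eq with triangle x y z
  ... | inj₁ p = d≡0⇒≡ (+-cancelˡ-≡ (d x y) _ _ (trans p (trans (sym eq) (sym (+-identityʳ (d x y))))))
  ... | inj₂ p = ⊥-elim (<⇒≢ (d<c y z) (+-cancelˡ-≡ (d x y) _ _ (trans p (cong (_+ c) (sym eq)))))

  ≤-triangle : ∀ x y z → d x z ≤ d x y + d y z
  ≤-triangle x y z with triangle x y z
  ... | inj₁ p = ≤-reflexive (sym p)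
  ... | inj₂ p = ≤-trans (m≤m+n (d x z) c) (≤-reflexive (sym p))

  sum<c⇒triangle : ∀ {x y z} → d x y + d y z < c → d x y + d y z ≡ d x z
  sum<c⇒triangle {x} {y} {z} lt with triangle x y z
  ... | inj₁ p = p
  ... | inj₂ p = ⊥-elim (<⇒≱ lt (≤-trans (m≤n+m c (d x z)) (≤-reflexive (sym p))))

  ≤⇒triangle : ∀ {x y z} → d x y ≤ d x z → d x y + d y z ≡ d x z
  ≤⇒triangle {x} {y} {z} le with triangle x y z
  ... | inj₁ p = p
  ... | inj₂ p = ⊥-elim (<⇒≱ (+-cancelʳ-< c (d x z) (d x y) z+c<y+c) le)
    where
      z+c<y+c : d x z + c < d x y + c
      z+c<y+c = subst (_< d x y + c) p (+-monoʳ-< (d x y) (d<c y z))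

  ≤⇒closer : ∀ {x y z} → x ≢ y → d x y ≤ d x z → d y z < d x z
  ≤⇒closer {x} {y} {z} x≢y le =
    subst (d y z <_) (trans (+-comm (d y z) (d x y)) (≤⇒triangle le)) (m<m+n (d y z) (d-pos x≢y))

  segment-flip : ∀ {x y z} → d z y ≤ d x y → d x z ≤ d x y
  segment-flip {x} {y} {z} le with triangle x z y
  ... | inj₁ p = ≤-trans (m≤m+n (d x z) (d z y)) (≤-reflexive p)
  ... | inj₂ p = ⊥-elim (<⇒≢ (+-mono-<-≤ (d<c x z) le) (trans p (+-comm (d x y) c)))

  segment⊆arc : ∀ {s x y ℓ} → d s x ≤ d s y → d s y ≤ ℓ → ∀ z → d x z ≤ d x y → d s z ≤ ℓ
  segment⊆arc {s} {x} {y} {ℓ} sx≤sy sy≤ℓ z xz≤xy = begin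
    d s z          ≤⟨ ≤-triangle s x z ⟩
    d s x + d x z  ≤⟨ +-monoʳ-≤ (d s x) xz≤xy ⟩
    d s x + d x y  ≡⟨ ≤⇒triangle sx≤sy ⟩
    d s y          ≤⟨ sy≤ℓ ⟩
    ℓ              ∎
    where open ≤-Reasoning

  arc-convex : ∀ {s x y ℓ} → d s x ≤ ℓ → d s y ≤ ℓ →
               (∀ z → d x z ≤ d x y → d s z ≤ ℓ) ⊎ (∀ z → d y z ≤ d y x → d s z ≤ ℓ)
  arc-convex {s} {x} {y} sx≤ℓ sy≤ℓ with ≤-total (d s x) (d s y)
  ... | inj₁ sx≤sy = inj₁ (segment⊆arc sx≤sy sy≤ℓ)
  ... | inj₂ sy≤sx = inj₂ (segment⊆arc sy≤sx sx≤ℓ)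

  flip-cyclic : IsCyclicDistance c (flip d)
  flip-cyclic = record
    { d<c      = flip d<c
    ; d≡0⇒≡    = sym ∘ d≡0⇒≡
    ; triangle = λ x y z → Sum.map (trans (+-comm (d y x) (d z y))) (trans (+-comm (d y x) (d z y))) (triangle z y x)
    }

  on-cyclic : ∀ {B : Set} {f : B → A} → Injective _≡_ _≡_ f → IsCyclicDistance c (d on f)
  on-cyclic {f = f} f-inj = record
    { d<c      = λ x y → d<c (f x) (f y)
    ; d≡0⇒≡    = f-inj ∘ d≡0⇒≡
    ; triangle = λ x y z → triangle (f x) (f y) (f z)
    }

  nearest-between : ∀ {y u v w} → Nearest d u w → d y u < d y v → d y u < d y w × d y w ≤ d y v
  nearest-between {y} {u} {v} {w} (w≢u , w-min) yu<yv =
    subst (d y u <_) yu+uw≡yw (m<m+n (d y u) (d-pos (≢-sym w≢u))) , subst (_≤ d y v) yu+uw≡yw yu+uw≤yv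
    where
      yu+uw≤yv : d y u + d u w ≤ d y v
      yu+uw≤yv = ≤-trans (+-monoʳ-≤ (d y u) (w-min v (λ { refl → <-irrefl refl yu<yv })))
                         (≤-reflexive (≤⇒triangle (<⇒≤ yu<yv)))
      yu+uw≡yw : d y u + d u w ≡ d y w
      yu+uw≡yw = sum<c⇒triangle (≤-<-trans yu+uw≤yv (d<c y v))

  nearest-flip : ∀ {u v} → Nearest d u v → Nearest (flip d) v u
  nearest-flip {u} {v} (v≢u , v-min) = ≢-sym v≢u , λ x x≢v → ≮⇒≥ (λ xv<uv →
    closer-than-nearest xv<uv x≢v (λ { refl → <-irrefl refl xv<uv }))
    where
      closer-than-nearest : ∀ {x} → d x v < d u v → x ≢ v → x ≢ u → ⊥
      closer-than-nearest {x} xv<uv x≢v x≢u =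
        x≢v (d-injʳ (≤-antisym (segment-flip (<⇒≤ xv<uv)) (v-min x x≢u)))

[m%n+k]%n≡[m+k]%n : ∀ m k n .{{_ : NonZero n}} → (m % n + k) % n ≡ (m + k) % n
[m%n+k]%n≡[m+k]%n m k n = begin
  (m % n + k) % n           ≡⟨ %-distribˡ-+ (m % n) k n ⟩
  (m % n % n + k % n) % n   ≡⟨ cong (λ t → (t + k % n) % n) (m%n%n≡m%n m n) ⟩
  (m % n + k % n) % n       ≡⟨ %-distribˡ-+ m k n ⟨
  (m + k) % n               ∎
  where open ≡-Reasoning

module Circle (k : ℕ) where

  cw : Fin (suc k) → Fin (suc k) → ℕ
  cw x y = (toℕ y + (suc k ∸ toℕ x)) % suc k

  private
    c = suc k

    +-around : ∀ {x} a → x ≤ c → x + (a + (c ∸ x)) ≡ a + c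
    +-around {x} a x≤c = begin
      x + (a + (c ∸ x))   ≡⟨ cong (x +_) (+-comm a (c ∸ x)) ⟩
      x + ((c ∸ x) + a)   ≡⟨ +-assoc x (c ∸ x) a ⟨
      (x + (c ∸ x)) + a   ≡⟨ cong (_+ a) (m+[n∸m]≡n x≤c) ⟩
      c + a               ≡⟨ +-comm c a ⟩
      a + c               ∎
      where open ≡-Reasoning

  cw<c : ∀ x y → cw x y < c
  cw<c x y = m%n<n (toℕ y + (c ∸ toℕ x)) c

  cw-spec : ∀ x y → (toℕ x + cw x y) % c ≡ toℕ y
  cw-spec x y = begin
    (toℕ x + cw x y) % c                      ≡⟨ cong (_% c) (+-comm (toℕ x) (cw x y)) ⟩
    (cw x y + toℕ x) % c                      ≡⟨ [m%n+k]%n≡[m+k]%n (toℕ y + (c ∸ toℕ x)) (toℕ x) c ⟩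
    (toℕ y + (c ∸ toℕ x) + toℕ x) % c         ≡⟨ cong (_% c) (+-comm _ (toℕ x)) ⟩
    (toℕ x + (toℕ y + (c ∸ toℕ x))) % c       ≡⟨ cong (_% c) (+-around (toℕ y) (<⇒≤ (toℕ<n x))) ⟩
    (toℕ y + c) % c                           ≡⟨ [m+n]%n≡m%n (toℕ y) c ⟩
    toℕ y % c                                 ≡⟨ m<n⇒m%n≡m (toℕ<n y) ⟩
    toℕ y                                     ∎
    where open ≡-Reasoning

  cw-unique : ∀ x y {a} → a < c → (toℕ x + a) % c ≡ toℕ y → cw x y ≡ a
  cw-unique x y {a} a<c eq = begin
    (toℕ y + (c ∸ toℕ x)) % c                ≡⟨ cong (λ t → (t + (c ∸ toℕ x)) % c) eq ⟨
    ((toℕ x + a) % c + (c ∸ toℕ x)) % c      ≡⟨ [m%n+k]%n≡[m+k]%n (toℕ x + a) (c ∸ toℕ x) c ⟩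
    (toℕ x + a + (c ∸ toℕ x)) % c            ≡⟨ cong (_% c) (+-assoc (toℕ x) a _) ⟩
    (toℕ x + (a + (c ∸ toℕ x))) % c          ≡⟨ cong (_% c) (+-around a (<⇒≤ (toℕ<n x))) ⟩
    (a + c) % c                              ≡⟨ [m+n]%n≡m%n a c ⟩
    a % c                                    ≡⟨ m<n⇒m%n≡m a<c ⟩
    a                                        ∎
    where open ≡-Reasoning

  ∈Arc⇒cw≤len : ∀ {x} a → x ∈Arc a → cw (Arc.start a) x ≤ Arc.len a
  ∈Arc⇒cw≤len (arc s ℓ ℓ<c) (j , j≤ℓ , eq) =
    ≤-trans (≤-reflexive (cw-unique s _ (≤-<-trans j≤ℓ ℓ<c) eq)) j≤ℓ

  cw≤len⇒∈Arc : ∀ {x} a → cw (Arc.start a) x ≤ Arc.len a → x ∈Arc a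
  cw≤len⇒∈Arc {x} (arc s ℓ _) le = cw s x , le , cw-spec s x

  cw-unique-<c+c : ∀ x y {a} → a < c + c → (toℕ x + a) % c ≡ toℕ y → a ≡ cw x y ⊎ a ≡ cw x y + c
  cw-unique-<c+c x y {a} a<2c eq with a <? c
  ... | yes a<c = inj₁ (sym (cw-unique x y a<c eq))
  ... | no a≮c = inj₂ (begin
    a                ≡⟨ a∸c+c≡a ⟨
    (a ∸ c) + c      ≡⟨ cong (_+ c) (cw-unique x y a∸c<c shifted) ⟨
    cw x y + c       ∎)
    where
      open ≡-Reasoning
      a∸c+c≡a : (a ∸ c) + c ≡ a
      a∸c+c≡a = m∸n+n≡m (≮⇒≥ a≮c)
      a∸c<c : a ∸ c < c
      a∸c<c = +-cancelʳ-< c (a ∸ c) c (subst (_< c + c) (sym a∸c+c≡a) a<2c)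
      shifted : (toℕ x + (a ∸ c)) % c ≡ toℕ y
      shifted = begin
        (toℕ x + (a ∸ c)) % c       ≡⟨ [m+n]%n≡m%n (toℕ x + (a ∸ c)) c ⟨
        (toℕ x + (a ∸ c) + c) % c   ≡⟨ cong (_% c) (+-assoc (toℕ x) (a ∸ c) c) ⟩
        (toℕ x + ((a ∸ c) + c)) % c ≡⟨ cong (λ t → (toℕ x + t) % c) a∸c+c≡a ⟩
        (toℕ x + a) % c             ≡⟨ eq ⟩
        toℕ y                       ∎

  cw-cyclic : IsCyclicDistance c cw
  cw-cyclic = record
    { d<c      = cw<c
    ; d≡0⇒≡    = λ {x} {y} eq → toℕ-injective (begin
        toℕ x                  ≡⟨ m<n⇒m%n≡m (toℕ<n x) ⟨
        toℕ x % c              ≡⟨ cong (_% c) (+-identityʳ (toℕ x)) ⟨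
        (toℕ x + 0) % c        ≡⟨ cong (λ t → (toℕ x + t) % c) eq ⟨
        (toℕ x + cw x y) % c   ≡⟨ cw-spec x y ⟩
        toℕ y                  ∎)
    ; triangle = λ x y z → cw-unique-<c+c x z (+-mono-< (cw<c x y) (cw<c y z)) (begin
        (toℕ x + (cw x y + cw y z)) % c          ≡⟨ cong (_% c) (+-assoc (toℕ x) (cw x y) (cw y z)) ⟨
        (toℕ x + cw x y + cw y z) % c            ≡⟨ [m%n+k]%n≡[m+k]%n (toℕ x + cw x y) (cw y z) c ⟨
        ((toℕ x + cw x y) % c + cw y z) % c      ≡⟨ cong (λ t → (t + cw y z) % c) (cw-spec x y) ⟩
        (toℕ y + cw y z) % c                     ≡⟨ cw-spec y z ⟩
        toℕ z                                    ∎)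
    }
    where open ≡-Reasoning

nearest : ∀ {N} (d : Fin N → Fin N → ℕ) {u v} → v ≢ u → ∃ (Nearest d u)
nearest {N} d {u} {v} v≢u = w , w≢u , w-min
  where
    others : List (Fin N)
    others = filter (λ x → ¬? (x ≟ u)) (allFin N)
    w : Fin N
    w = argmin (d u) v others
    w≢u : w ≢ u
    w≢u with argmin-sel (d u) v others
    ... | inj₁ w≡v = subst (_≢ u) (sym w≡v) v≢u
    ... | inj₂ w∈others = proj₂ (∈-filter⁻ (λ x → ¬? (x ≟ u)) {xs = allFin N} w∈others)
    w-min : ∀ x → x ≢ u → d u w ≤ d u x
    w-min x x≢u = All.lookup (f[argmin]≤f[xs] v others) (∈-filter⁺ (λ x → ¬? (x ≟ u)) (∈-allFin x) x≢u)

-- For clockwise distances d, the arc of u catches the clockwise neighbour of u; for flip d, the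
-- counter-clockwise one.
CatchesNearest : ∀ {n} → (Fin n → Fin n → ℕ) → Digraph n → Fin n → Set
CatchesNearest d E u = ∀ v → Nearest d u v → E u v

module _ {N c} {d : Fin N → Fin N → ℕ} {E : Digraph N} (cyc : IsCyclicDistance c d) (oriented : Oriented E)
         (catches : ∀ u → CatchesNearest d E u ⊎ CatchesNearest (flip d) E u) where
  open CyclicDistance cyc

  -- Descent on d u v: the nearest neighbour w of u yields a closer opposite pair (w, v) or (u, w),
  -- unless w = v, and then u and v catch each other.
  opposite-catchers-⊥ : ∀ {u v} → CatchesNearest d E u → CatchesNearest (flip d) E v → u ≢ v → ⊥
  opposite-catchers-⊥ {u} {v} = go u v (<-wellFounded (d u v))
    where
      go : ∀ u v → Acc _<_ (d u v) → CatchesNearest d E u → CatchesNearest (flip d) E v → u ≢ v → ⊥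
      go u v (acc descend) u-cw v-ccw u≢v with nearest d (≢-sym u≢v)
      ... | w , w-near@(w≢u , w-min) with w ≟ v
      ...   | yes refl = oriented u w u≢v (u-cw w w-near) (v-ccw u (nearest-flip w-near))
      ...   | no w≢v with catches w
      ...     | inj₁ w-cw  = go w v (descend (≤⇒closer (≢-sym w≢u) (w-min v (≢-sym u≢v)))) w-cw v-ccw w≢v
      ...     | inj₂ w-ccw =
        go u w (descend (≤∧≢⇒< (w-min v (≢-sym u≢v)) (w≢v ∘ d-injʳ))) u-cw w-ccw (≢-sym w≢u)

  catches-nearest-everywhere : ∀ {u₀} → CatchesNearest d E u₀ → ∀ u → CatchesNearest d E u
  catches-nearest-everywhere {u₀} u₀-cw u with u ≟ u₀ | catches u
  ... | yes refl | _         = u₀-cw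
  ... | no _     | inj₁ u-cw = u-cw
  ... | no u≢u₀  | inj₂ u-ccw = ⊥-elim (opposite-catchers-⊥ u₀-cw u-ccw (≢-sym u≢u₀))

catches-nearest-uniformly : ∀ {N c} {d : Fin N → Fin N → ℕ} {E : Digraph N} → IsCyclicDistance c d → Oriented E →
  (∀ u → CatchesNearest d E u ⊎ CatchesNearest (flip d) E u) → Fin N →
  (∀ u → CatchesNearest d E u) ⊎ (∀ u → CatchesNearest (flip d) E u)
catches-nearest-uniformly cyc oriented catches u₀ with catches u₀
... | inj₁ u₀-cw  = inj₁ (catches-nearest-everywhere cyc oriented catches u₀-cw)
... | inj₂ u₀-ccw = inj₂ (catches-nearest-everywhere (CyclicDistance.flip-cyclic cyc) oriented (swap ∘ catches) u₀-ccw)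

edge⇒≢ : ∀ {n} {E : Digraph n} → Loopless E → ∀ {u v} → E u v → u ≢ v
edge⇒≢ loopless {u} e refl = loopless u e

Avoiding : ∀ {n} → Digraph n → Fin n → Digraph n
Avoiding E y u v = E u v × v ≢ y

lift-avoiding : ∀ {m} {E : Digraph (suc m)} {y u v} → Star (Avoiding E y) u v →
                ∀ {a b} → u ≡ punchIn y a → v ≡ punchIn y b → Star (E on punchIn y) a b
lift-avoiding {y = y} ε {a} {b} refl v≡ = subst (Star _ a) (punchIn-injective y a b v≡) ε
lift-avoiding {E = E} {y} ((e , w≢y) ◅ path) {a} refl v≡ =
  subst (E (punchIn y a)) (sym (punchIn-punchOut (≢-sym w≢y))) e ◅
  lift-avoiding path (sym (punchIn-punchOut (≢-sym w≢y))) v≡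

Sink : ∀ {n} → Digraph n → Fin n → Set
Sink E z = ∀ w → ¬ E z w

SinkFreeExcept : ∀ {n} → Digraph n → Fin n → Set
SinkFreeExcept E y = ∀ z → Sink E z → z ≡ y

sink? : ∀ {n} {E : Digraph n} → Decidable E → ∀ z → Dec (Sink E z)
sink? dec z = all? (λ w → ¬? (dec z w))

path-from-sink : ∀ {n} {E : Digraph n} {y v} → Sink E y → Star E y v → y ≡ v
path-from-sink _      ε       = refl
path-from-sink y-sink (e ◅ _) = ⊥-elim (y-sink _ e)

sink-unique : ∀ {n} {E : Digraph n} → Unilateral E → ∀ {x y} → Sink E x → Sink E y → x ≡ y
sink-unique unilateral {x} {y} x-sink y-sink with x ≟ y
... | yes x≡y = x≡y
... | no x≢y with unilateral x y x≢y
...   | inj₁ path = path-from-sink x-sink path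
...   | inj₂ path = sym (path-from-sink y-sink path)

avoid-sink : ∀ {n} {E : Digraph n} {y u v} → Sink E y → Star E u v → v ≢ y → Star (Avoiding E y) u v
avoid-sink y-sink ε _ = ε
avoid-sink {y = y} y-sink (_◅_ {j = w} e path) v≢y with w ≟ y
... | yes refl = ⊥-elim (v≢y (sym (path-from-sink y-sink path)))
... | no w≢y   = (e , w≢y) ◅ avoid-sink y-sink path v≢y

last-edge : ∀ {n} {E : Digraph n} {u v} → u ≢ v → Star E u v → ∃ λ q → E q v
last-edge u≢v ε = ⊥-elim (u≢v refl)
last-edge {E = E} _ (e ◅ path) = from e path
  where
    from : ∀ {u w v} → E u w → Star E w v → ∃ λ q → E q v
    from e ε          = _ , e
    from _ (e ◅ path) = from e path

-- What appending y to a Hamiltonian path of the digraph without y requires.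
Removable : ∀ {m} → Digraph (suc m) → Fin (suc m) → Set
Removable E y = Unilateral (E on punchIn y) × ∃ λ q → E q y

sink-removable : ∀ {m} {E : Digraph (suc (suc m))} {y} → Unilateral E → Sink E y → Removable E y
sink-removable {E = E} {y} unilateral y-sink = unilateral-rest , in-neighbour
  where
    lift : ∀ a b → Star E (punchIn y a) (punchIn y b) → Star (E on punchIn y) a b
    lift a b path = lift-avoiding (avoid-sink y-sink path (punchInᵢ≢i y b)) refl refl
    unilateral-rest : Unilateral (E on punchIn y)
    unilateral-rest a b a≢b =
      Sum.map (lift a b) (lift b a) (unilateral (punchIn y a) (punchIn y b) (a≢b ∘ punchIn-injective y a b))
    in-neighbour : ∃ λ q → E q y
    in-neighbour with unilateral (punchIn y fzero) y (punchInᵢ≢i y fzero)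
    ... | inj₁ path = last-edge (punchInᵢ≢i y fzero) path
    ... | inj₂ path = ⊥-elim (punchInᵢ≢i y fzero (sym (path-from-sink y-sink path)))

module _ {m c} {d : Fin (suc (suc m)) → Fin (suc (suc m)) → ℕ} {E : Digraph (suc (suc m))}
         (cyc : IsCyclicDistance c d) (catches : ∀ u → CatchesNearest d E u) (y : Fin (suc (suc m))) where
  open CyclicDistance cyc

  clockwise-walk : ∀ {u v} → d y u < d y v → Star (Avoiding E y) u v
  clockwise-walk {u} {v} = go u v (<-wellFounded (d u v))
    where
      w≢y : ∀ {u w} → d y u < d y w → w ≢ y
      w≢y {u} yu<yw refl = n≮0 (subst (d y u <_) (d-refl y) yu<yw)

      v≢u : ∀ {u v} → d y u < d y v → v ≢ u
      v≢u yu<yv refl = <-irrefl refl yu<yv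

      go : ∀ u v → Acc _<_ (d u v) → d y u < d y v → Star (Avoiding E y) u v
      go u v (acc descend) yu<yv with nearest d (v≢u yu<yv)
      ... | w , w-near@(w≢u , w-min) with nearest-between {y = y} w-near yu<yv | w ≟ v
      ...   | yu<yw , _     | yes refl = (catches u w w-near , w≢y yu<yw) ◅ ε
      ...   | yu<yw , yw≤yv | no w≢v   = (catches u w w-near , w≢y yu<yw) ◅
        go w v (descend (≤⇒closer (≢-sym w≢u) (w-min v (v≢u yu<yv)))) (≤∧≢⇒< yw≤yv (w≢v ∘ d-injʳ))

  clockwise-removable : Removable E y
  clockwise-removable = unilateral-rest , in-neighbour
    where
      unilateral-rest : Unilateral (E on punchIn y)
      unilateral-rest a b a≢b with <-cmp (d y (punchIn y a)) (d y (punchIn y b))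
      ... | tri< lt _ _ = inj₁ (lift-avoiding (clockwise-walk lt) refl refl)
      ... | tri≈ _ eq _ = ⊥-elim (a≢b (punchIn-injective y a b (d-injʳ eq)))
      ... | tri> _ _ gt = inj₂ (lift-avoiding (clockwise-walk gt) refl refl)
      in-neighbour : ∃ λ q → E q y
      in-neighbour with nearest (flip d) (punchInᵢ≢i y fzero)
      ... | q , q-near = q , catches q y (CyclicDistance.nearest-flip flip-cyclic q-near)

module CatchRepresentation {n} {E : Digraph n} (loopless : Loopless E)
         (k : ℕ) (I : Fin n → Arc (suc k)) (p : Fin n → Fin (suc k)) (own : ∀ v → p v ∈Arc I v)
         (catch : ∀ u v → u ≢ v → (E u v → p v ∈Arc I u) × (p v ∈Arc I u → E u v)) where
  open Circle k

  Covers : Fin n → Fin (suc k) → Set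
  Covers u x = cw (Arc.start (I u)) x ≤ Arc.len (I u)

  covers⇒edge : ∀ {u v} → u ≢ v → Covers u (p v) → E u v
  covers⇒edge {u} {v} u≢v = proj₂ (catch u v u≢v) ∘ cw≤len⇒∈Arc (I u)

  edge⇒covers : ∀ {u v} → E u v → Covers u (p v)
  edge⇒covers {u} {v} e = ∈Arc⇒cw≤len (I u) (proj₁ (catch u v (edge⇒≢ {E = E} loopless e)) e)

  covers-own : ∀ u → Covers u (p u)
  covers-own u = ∈Arc⇒cw≤len (I u) (own u)

  decidable : Decidable E
  decidable u v with u ≟ v
  ... | yes refl = no (loopless u)
  ... | no u≢v   = map′ (covers⇒edge u≢v) edge⇒covers (_ ≤? _)

  module _ (oriented : Oriented E) where

    p-injective : Injective _≡_ _≡_ p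
    p-injective {u} {v} pu≡pv with u ≟ v
    ... | yes u≡v = u≡v
    ... | no u≢v  = ⊥-elim (oriented u v u≢v
      (covers⇒edge u≢v (subst (Covers u) pu≡pv (covers-own u)))
      (covers⇒edge (≢-sym u≢v) (subst (Covers v) (sym pu≡pv) (covers-own v))))

    d : Fin n → Fin n → ℕ
    d = cw on p

    d-cyclic : IsCyclicDistance (suc k) d
    d-cyclic = CyclicDistance.on-cyclic cw-cyclic p-injective

    edge⇒catches-nearest : ∀ {u v} → E u v → CatchesNearest d E u ⊎ CatchesNearest (flip d) E u
    edge⇒catches-nearest {u} {v} e
      with CyclicDistance.arc-convex cw-cyclic {s = Arc.start (I u)} {x = p u} {y = p v} (covers-own u) (edge⇒covers e)
    ... | inj₁ cw-segment  = inj₁ λ w (w≢u , w-min) →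
      covers⇒edge (≢-sym w≢u) (cw-segment (p w) (w-min v v≢u))
      where v≢u = ≢-sym (edge⇒≢ {E = E} loopless e)
    ... | inj₂ ccw-segment = inj₂ λ w (w≢u , w-min) →
      covers⇒edge (≢-sym w≢u)
        (ccw-segment (p w) (CyclicDistance.segment-flip cw-cyclic {x = p v} {y = p u} {z = p w} (w-min v v≢u)))
      where v≢u = ≢-sym (edge⇒≢ {E = E} loopless e)

catch-decidable : ∀ {n} {E : Digraph n} → Loopless E → IsCircularArcCatchDigraph E → Decidable E
catch-decidable loopless (k , I , p , own , catch) = CatchRepresentation.decidable loopless k I p own catch

sinkless-removable : ∀ {m} {E : Digraph (suc (suc m))} → Loopless E → IsCircularArcCatchDigraph E → Oriented E →
                     (∀ u → ¬ Sink E u) → ∀ y → Removable E y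
sinkless-removable {E = E} loopless (k , I , p , own , catch) oriented sinkless y =
  removable (catches-nearest-uniformly (d-cyclic oriented) oriented
               (λ u → edge⇒catches-nearest oriented (proj₂ (out-neighbour u))) y)
  where
    open CatchRepresentation loopless k I p own catch
    removable : (∀ u → CatchesNearest (d oriented) E u) ⊎ (∀ u → CatchesNearest (flip (d oriented)) E u) →
                Removable E y
    removable (inj₁ cw)  = clockwise-removable (d-cyclic oriented) cw y
    removable (inj₂ ccw) = clockwise-removable (CyclicDistance.flip-cyclic (d-cyclic oriented)) ccw y
    out-neighbour : ∀ u → ∃ (E u)
    out-neighbour u with ¬∀⟶∃¬ _ (λ w → ¬ E u w) (λ w → ¬? (decidable u w)) (sinkless u)
    ... | w , ¬¬e = w , decidable-stable (decidable u w) ¬¬e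

loopless-on : ∀ {m n} {E : Digraph n} (f : Fin m → Fin n) → Loopless E → Loopless (E on f)
loopless-on f loopless = loopless ∘ f

oriented-on : ∀ {m n} {E : Digraph n} {f : Fin m → Fin n} → Injective _≡_ _≡_ f → Oriented E → Oriented (E on f)
oriented-on f-inj oriented a b a≢b = oriented _ _ (a≢b ∘ f-inj)

catch-on : ∀ {m n} {E : Digraph n} {f : Fin m → Fin n} → Injective _≡_ _≡_ f →
           IsCircularArcCatchDigraph E → IsCircularArcCatchDigraph (E on f)
catch-on {f = f} f-inj (k , I , p , own , catch) =
  k , I ∘ f , p ∘ f , own ∘ f , λ a b a≢b → catch (f a) (f b) (a≢b ∘ f-inj)

choose-end : ∀ {n} {E : Digraph n} → Decidable E → Unilateral E → (y₀ : Fin n) →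
             ∃ λ y → SinkFreeExcept E y × (Sink E y ⊎ y ≡ y₀)
choose-end dec unilateral y₀ with any? (sink? dec)
... | yes (z , z-sink) = z , (λ _ sink → sink-unique unilateral sink z-sink) , inj₁ z-sink
... | no no-sink       = y₀ , (λ z z-sink → ⊥-elim (no-sink (z , z-sink))) , inj₂ refl

sink-on-punchIn : ∀ {m} {E : Digraph (suc m)} {y z} →
                  Sink (E on punchIn y) z → ¬ E (punchIn y z) y → Sink E (punchIn y z)
sink-on-punchIn {E = E} {y} {z} z-sink ¬e w e with y ≟ w
... | yes refl = ¬e e
... | no y≢w   = z-sink (punchOut y≢w) (subst (E (punchIn y z)) (sym (punchIn-punchOut y≢w)) e)

edge-from-rest : ∀ {m} {E : Digraph (suc m)} {y q} → Loopless E → E q y → ∃ λ q' → E (punchIn y q') y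
edge-from-rest {E = E} {y} loopless q→y = punchOut y≢q , subst (λ x → E x y) (sym (punchIn-punchOut y≢q)) q→y
  where
    y≢q : y ≢ _
    y≢q = ≢-sym (edge⇒≢ {E = E} loopless q→y)

next-end : ∀ {m} {E : Digraph (suc (suc m))} {y} → Decidable E → Loopless E → SinkFreeExcept E y → Removable E y →
           ∃ λ y' → SinkFreeExcept (E on punchIn y) y' × E (punchIn y y') y
next-end {E = E} {y} dec loopless only-y (unilateral , _ , q→y) with edge-from-rest {E = E} loopless q→y
... | q , q→y′ with choose-end (λ a b → dec (punchIn y a) (punchIn y b)) unilateral q
...   | y' , only-y' , inj₂ refl = y' , only-y' , q→y′
...   | y' , only-y' , inj₁ y'-sink with dec (punchIn y y') y
...     | yes e = y' , only-y' , e
...     | no ¬e = ⊥-elim (punchInᵢ≢i y y' (only-y _ (sink-on-punchIn {E = E} y'-sink ¬e)))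

record HamiltonianPathFrom {n} (R : Digraph n) (y : Fin n) : Set where
  field
    vertex    : ℕ → Fin n
    starts    : vertex 0 ≡ y
    injective : ∀ {i j} → i < n → j < n → vertex i ≡ vertex j → i ≡ j
    step      : ∀ i → suc i < n → R (vertex i) (vertex (suc i))

trivial-path : ∀ {R : Digraph 1} y → HamiltonianPathFrom R y
trivial-path y = record
  { vertex    = λ _ → y
  ; starts    = refl
  ; injective = λ { (s≤s z≤n) (s≤s z≤n) _ → refl }
  ; step      = λ { _ (s≤s ()) }
  }

cons-path : ∀ {m} {R : Digraph (suc m)} {y y'} → R y (punchIn y y') →
            HamiltonianPathFrom (R on punchIn y) y' → HamiltonianPathFrom R y
cons-path {R = R} {y} {y'} y→y' path = record
  { vertex    = vertex′
  ; starts    = refl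
  ; injective = injective′
  ; step      = step′
  }
  where
    open HamiltonianPathFrom path
    vertex′ : ℕ → Fin _
    vertex′ zero    = y
    vertex′ (suc i) = punchIn y (vertex i)
    injective′ : ∀ {i j} → i < suc _ → j < suc _ → vertex′ i ≡ vertex′ j → i ≡ j
    injective′ {zero}  {zero}  _ _ _ = refl
    injective′ {zero}  {suc j} _ _ eq = ⊥-elim (punchInᵢ≢i y (vertex j) (sym eq))
    injective′ {suc i} {zero}  _ _ eq = ⊥-elim (punchInᵢ≢i y (vertex i) eq)
    injective′ {suc i} {suc j} (s≤s i<) (s≤s j<) eq = cong suc (injective i< j< (punchIn-injective y _ _ eq))
    step′ : ∀ i → suc i < suc _ → R (vertex′ i) (vertex′ (suc i))
    step′ zero    _        = subst (λ x → R y (punchIn y x)) (sym starts) y→y'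
    step′ (suc i) (s≤s lt) = step i lt

reverse-path : ∀ {m} {E : Digraph (suc m)} {y} → HamiltonianPathFrom (flip E) y → HasHamiltonianPath E
reverse-path {m} {E} path = σ , σ-injective , σ-step
  where
    open HamiltonianPathFrom path
    σ : Fin (suc m) → Fin (suc m)
    σ i = vertex (m ∸ toℕ i)
    m∸i<1+m : ∀ i → m ∸ i < suc m
    m∸i<1+m i = s≤s (m∸n≤m m i)
    σ-injective : Injective _≡_ _≡_ σ
    σ-injective {i} {j} eq = toℕ-injective (begin
      toℕ i              ≡⟨ m∸[m∸n]≡n (≤-pred (toℕ<n i)) ⟨
      m ∸ (m ∸ toℕ i)    ≡⟨ cong (m ∸_) (injective (m∸i<1+m (toℕ i)) (m∸i<1+m (toℕ j)) eq) ⟩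
      m ∸ (m ∸ toℕ j)    ≡⟨ m∸[m∸n]≡n (≤-pred (toℕ<n j)) ⟩
      toℕ j              ∎)
      where open ≡-Reasoning
    σ-step : (i : ℕ) (i+1<n : suc i < suc m) →
             E (σ (fromℕ< (<-trans (n<1+n i) i+1<n))) (σ (fromℕ< i+1<n))
    σ-step i (s≤s i<m) rewrite toℕ-fromℕ< (<-trans (n<1+n i) (s≤s i<m)) | toℕ-fromℕ< (s≤s i<m) =
      subst (λ j → E (vertex j) (vertex (m ∸ suc i))) (sym (+-∸-assoc 1 i<m))
            (step (m ∸ suc i) (s≤s (∸-monoʳ-< z<s i<m)))

hamiltonian-path-into : ∀ m {E : Digraph (suc m)} → Loopless E → IsCircularArcCatchDigraph E → Oriented E →
                        Unilateral E → ∀ {y} → SinkFreeExcept E y → HamiltonianPathFrom (flip E) y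
hamiltonian-path-into zero _ _ _ _ _ = trivial-path _
hamiltonian-path-into (suc m) {E} loopless catch oriented unilateral {y} only-y =
  extend (next-end dec loopless only-y removable)
  where
    dec : Decidable E
    dec = catch-decidable loopless catch
    removable : Removable E y
    removable with sink? dec y
    ... | yes y-sink = sink-removable unilateral y-sink
    ... | no ¬y-sink = sinkless-removable loopless catch oriented
                         (λ u u-sink → ¬y-sink (subst (Sink E) (only-y u u-sink) u-sink)) y
    punchIn-inj : Injective _≡_ _≡_ (punchIn y)
    punchIn-inj = punchIn-injective y _ _
    extend : (∃ λ y' → SinkFreeExcept (E on punchIn y) y' × E (punchIn y y') y) → HamiltonianPathFrom (flip E) y
    extend (_ , only-y' , y'→y) = cons-path y'→y
      (hamiltonian-path-into m (loopless-on {E = E} (punchIn y) loopless) (catch-on punchIn-inj catch)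
                               (oriented-on punchIn-inj oriented) (proj₁ removable) only-y')

mainTheorem3 : (n : ℕ) (E : Digraph n) → Loopless E →
    IsCircularArcCatchDigraph E → Oriented E → Unilateral E →
    HasHamiltonianPath E
mainTheorem3 zero E _ _ _ _ = (λ ()) , (λ { {()} }) , (λ _ ())
mainTheorem3 (suc m) E loopless catch oriented unilateral
  with choose-end (catch-decidable loopless catch) unilateral fzero
... | _ , only-y , _ = reverse-path (hamiltonian-path-into m loopless catch oriented unilateral only-y)
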